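{- Let $\Delta$ be a simplicial pseudomanifold of dimension $d-1$. (i) If $\sigma$ is any subset of the vertex set of $\Delta$ with $|\sigma|<d$, then any two vertices of $\Delta$ not in $\sigma$ can be connected by a $\Delta$-strong walk in $\mathcal{G}(\Delta)\smallsetminus\sigma$. In particular, $\mathcal{G}(\Delta)$ is $d$-connected. (ii) If $\sigma$ is a face of $\Delta$, then any two vertices of $\Delta$ not in $\sigma$ can be connected by a $\Delta$-strong walk in $\mathcal{G}(\Delta)\smallsetminus\sigma$. In particular, $\mathcal{G}(\Delta)\smallsetminus\sigma$ is connected.
   Context: A sequence $(\tau_0,\dots,\tau_n)$ of facets is a strong chain if $\tau_{i-1}\cap\tau_i$ is a codimension one face of both $\tau_{i-1}$ and $\tau_i$ for all $i$. Two facets are equivalent if joined by a strong chain; a strong component of a complex is the complex of all subsets of facets in one equivalence class, and a complex is strongly connected if it has a unique strong component. A $(d-1)$-dimensional simplicial complex is a pseudomanifold if it is strongly connected and each $(d-2)$-dimensional face lies in exactly two facets. $\mathcal{G}(\Delta)$ is the $1$-skeleton of $\Delta$, and $\mathcal{G}(\Delta)\smallsetminus\sigma$ is the graph obtained by deleting the vertices in $\sigma$ and their incident edges. The closed star of a vertex $v$ is the subcomplex of all subsets of faces containing $v$. A walk $(v_0,e_1,v_1,\dots,e_n,v_n)$ in $\mathcal{G}(\Delta)$ (with $e_i=\{v_{i-1},v_i\}$) is $\Delta$-strong if there exist facets $\tau_1,\dots,\tau_n$ of $\Delta$ with $e_i\subseteq\tau_i$ such that $\tau_i$ and $\tau_{i+1}$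 lie in the same strong component of the closed star of $v_i$ in $\Delta$ for all $1\le i\le n-1$. A graph is $m$-connected if it has at least $m+1$ nodes and remains connected after deleting any fewer than $m$ nodes. -}

module Defs where

open import Level using (0ℓ)
open import Data.Nat using (ℕ; zero; suc; _+_; _≤_; _<_)
open import Data.Fin using (Fin; zero; suc; toℕ; fromℕ; inject₁)
open import Data.Fin.Subset using (Subset; _∈_; _∉_; _⊆_; _∩_; _∪_; ⁅_⁆; ∣_∣)
open import Data.Product using (Σ; ∃; ∃-syntax; _×_; _,_)
open import Data.Sum using (_⊎_)
open import Relation.Binary.PropositionalEquality using (_≡_; _≢_)
open import Relation.Binary.Construct.Closure.ReflexiveTransitive using (Star)

-- A (finite) simplicial complex on the ground set Fin n is given by the
-- predicate "is a face"; it must be closed under taking subsets.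
Complex : ℕ → Set₁
Complex n = Subset n → Set

IsSimplicialComplex : ∀ {n} → Complex n → Set
IsSimplicialComplex {n} Δ = ∀ (ρ τ : Subset n) → Δ τ → ρ ⊆ τ → Δ ρ

IsVertex : ∀ {n} → Complex n → Fin n → Set
IsVertex Δ v = Δ ⁅ v ⁆

Facet : ∀ {n} → Complex n → Subset n → Set
Facet {n} Δ τ = Δ τ × (∀ (ρ : Subset n) → Δ ρ → τ ⊆ ρ → ρ ≡ τ)

CodimOne : ∀ {n} → Subset n → Subset n → Set
CodimOne ρ τ = ρ ⊆ τ × suc ∣ ρ ∣ ≡ ∣ τ ∣

StrongStep : ∀ {n} → Complex n → Subset n → Subset n → Set
StrongStep Δ τ τ' = Facet Δ τ × Facet Δ τ' × CodimOne (τ ∩ τ') τ × CodimOne (τ ∩ τ') τ'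

StrongEquiv : ∀ {n} → Complex n → Subset n → Subset n → Set
StrongEquiv Δ τ τ' = Facet Δ τ × Star (StrongStep Δ) τ τ'

-- ρ belongs to the strong component of Δ determined by the facet `rep`
-- (the complex of all subsets of facets strongly equivalent to rep)
InComponent : ∀ {n} → Complex n → Subset n → Subset n → Set
InComponent Δ rep ρ = ∃[ τ ] (StrongEquiv Δ rep τ × ρ ⊆ τ)

SameComponent : ∀ {n} → Complex n → Subset n → Subset n → Set
SameComponent Δ ρ ρ' = ∃[ rep ] (Facet Δ rep × InComponent Δ rep ρ × InComponent Δ rep ρ')

StronglyConnected : ∀ {n} → Complex n → Set
StronglyConnected {n} Δ =
  (∃[ τ ] Facet Δ τ) × (∀ (τ τ' : Subset n) → Facet Δ τ → Facet Δ τ' → StrongEquiv Δ τ τ')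

-- Δ has dimension d - 1: it has a face with d vertices and no larger face
HasDimensionPred : ∀ {n} → Complex n → ℕ → Set
HasDimensionPred {n} Δ d = (∃[ σ ] (Δ σ × ∣ σ ∣ ≡ d)) × (∀ (σ : Subset n) → Δ σ → ∣ σ ∣ ≤ d)

InExactlyTwoFacets : ∀ {n} → Complex n → Subset n → Set
InExactlyTwoFacets {n} Δ ρ =
  ∃[ τ₁ ] ∃[ τ₂ ] (τ₁ ≢ τ₂ × Facet Δ τ₁ × Facet Δ τ₂ × ρ ⊆ τ₁ × ρ ⊆ τ₂ ×
     (∀ (τ : Subset n) → Facet Δ τ → ρ ⊆ τ → (τ ≡ τ₁ ⊎ τ ≡ τ₂)))

IsPseudomanifold : ∀ {n} → Complex n → ℕ → Set
IsPseudomanifold {n} Δ d =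
  IsSimplicialComplex Δ × HasDimensionPred Δ d × StronglyConnected Δ ×
  (∀ (ρ : Subset n) → Δ ρ → suc ∣ ρ ∣ ≡ d → InExactlyTwoFacets Δ ρ)

ClosedStar : ∀ {n} → Complex n → Fin n → Complex n
ClosedStar Δ v ρ = ∃[ τ ] (Δ τ × v ∈ τ × ρ ⊆ τ)

edge : ∀ {n} → Fin n → Fin n → Subset n
edge u w = ⁅ u ⁆ ∪ ⁅ w ⁆

-- a walk from u to w in the graph 𝒢(Δ) ∖ σ  (1-skeleton with the vertices of σ deleted)
record Walk {n} (Δ : Complex n) (σ : Subset n) (u w : Fin n) : Set where
  field
    len      : ℕ
    vert     : Fin (suc len) → Fin n
    start    : vert zero ≡ u
    finish   : vert (fromℕ len) ≡ w
    isVertex : ∀ i → IsVertex Δ (vert i)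
    avoids   : ∀ i → vert i ∉ σ
    distinct : ∀ (i : Fin len) → vert (inject₁ i) ≢ vert (suc i)
    isEdge   : ∀ (i : Fin len) → Δ (edge (vert (inject₁ i)) (vert (suc i)))

-- a Δ-strong walk from u to w in 𝒢(Δ) ∖ σ.
-- Edge number i (0-based) is e = {vert (inject₁ i), vert (suc i)} and fac i is its facet τ.
record StrongWalk {n} (Δ : Complex n) (σ : Subset n) (u w : Fin n) : Set where
  field
    walk : Walk Δ σ u w
  open Walk walk public
  field
    fac      : Fin len → Subset n
    facIsFacet : ∀ i → Facet Δ (fac i)
    edgeInFac  : ∀ i → edge (vert (inject₁ i)) (vert (suc i)) ⊆ fac i
    strong   : ∀ (i j : Fin len) → suc (toℕ i) ≡ toℕ j →
                 SameComponent (ClosedStar Δ (vert (suc i))) (fac i) (fac j)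

ConnectedAvoiding : ∀ {n} → Complex n → Subset n → Set
ConnectedAvoiding {n} Δ σ =
  (∃[ v ] (IsVertex Δ v × v ∉ σ)) ×
  (∀ (u w : Fin n) → IsVertex Δ u → IsVertex Δ w → u ∉ σ → w ∉ σ → Walk Δ σ u w)

IsMConnected : ∀ {n} → Complex n → ℕ → Set
IsMConnected {n} Δ m =
  (∃[ S ] ((∀ v → v ∈ S → IsVertex Δ v) × suc m ≤ ∣ S ∣)) ×
  (∀ (S : Subset n) → (∀ v → v ∈ S → IsVertex Δ v) → ∣ S ∣ < m → ConnectedAvoiding Δ S)

module Submission where

-- Join facets of the two vertices by a strong chain of facets.  If
-- consecutive facets of the chain always share a vertex outside σ (an
-- "avoiding chain"), walking from shared vertex to shared vertex gives the
-- walk, and it is Δ-strong because two consecutive facets through a vertex v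
-- are adjacent in the closed star of v.  A step whose two facets meet only
-- inside σ is replaced by a detour around a face κ ⊆ σ with d - 2 vertices:
-- the facets containing κ form a cycle (every ridge lies in exactly two
-- facets, so the link of κ is 2-regular), and going round it the other way
-- only pivots on vertices outside σ.  When |σ| < d such a step crosses the
-- ridge σ itself; when σ is a facet the chain passes through σ, and one
-- rotates around σ with two vertices removed.


open import Defs
open import Data.Nat using (ℕ; zero; suc; _+_; _^_; _≤_; _<_; z≤n; s≤s; s≤s⁻¹; _≤?_)
import Data.Nat.Properties as ℕ
open import Data.Bool using (true; false) renaming (_≟_ to _≟ᵇ_)
open import Data.Fin using (Fin; zero; suc; toℕ; fromℕ<; inject₁)
open import Data.Fin.Properties using (any?; pigeonhole; toℕ<n; toℕ-fromℕ<) renaming (_≟_ to _≟ᶠ_)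
open import Data.Fin.Subset
  using (Subset; _∈_; _∉_; _⊆_; _⊃_; _∩_; _∪_; _-_; ⁅_⁆; ∣_∣; inside; outside) renaming (⊥ to ∅)
open import Data.Fin.Subset.Properties
open import Data.Fin.Subset.Induction using (⊃-wellFounded)
open import Data.Vec using ([]; _∷_; here; there)
open import Data.Vec.Properties using (≡-dec)
open import Data.List using (List; []; _∷_; _++_; allFin; concatMap)
open import Data.List.Relation.Unary.Any as Any using (Any; here; there)
open import Data.List.Relation.Unary.Any.Properties using (++⁺ˡ; ++⁺ʳ; concat⁺; map⁺)
open import Data.List.Membership.Propositional using (lose)
open import Data.List.Membership.Propositional.Properties using (∈-allFin)
open import Data.Product using (Σ; ∃; ∃-syntax; _×_; _,_; proj₁; proj₂)
open import Data.Sum using (_⊎_; inj₁; inj₂)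
open import Data.Empty using (⊥-elim)
open import Induction.WellFounded using (Acc; acc)
open import Relation.Nullary using (¬_; Dec; yes; no)
open import Relation.Nullary.Decidable using (_×-dec_; ¬?; map′)
open import Relation.Unary using (Decidable)
open import Relation.Binary.PropositionalEquality
open import Relation.Binary.Definitions using (tri<; tri≈; tri>)
open import Relation.Binary.Construct.Closure.ReflexiveTransitive using (Star; ε; _◅_; _◅◅_)

_≟ₛ_ : ∀ {n} (p q : Subset n) → Dec (p ≡ q)
_≟ₛ_ = ≡-dec _≟ᵇ_

⊈⇒witness : ∀ {n} {τ ρ : Subset n} → ¬ τ ⊆ ρ → ∃[ x ] (x ∈ τ × x ∉ ρ)
⊈⇒witness {n} {τ} {ρ} τ⊈ρ with any? {n = n} (λ x → x ∈? τ ×-dec ¬? (x ∈? ρ))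
... | yes witness = witness
... | no none = ⊥-elim (τ⊈ρ τ⊆ρ)
  where
  τ⊆ρ : τ ⊆ ρ
  τ⊆ρ {x} x∈τ with x ∈? ρ
  ... | yes x∈ρ = x∈ρ
  ... | no x∉ρ = ⊥-elim (none (x , x∈τ , x∉ρ))

larger⇒witness : ∀ {n} {τ ρ : Subset n} → ∣ ρ ∣ < ∣ τ ∣ → ∃[ x ] (x ∈ τ × x ∉ ρ)
larger⇒witness ρ<τ = ⊈⇒witness (λ τ⊆ρ → ℕ.<⇒≱ ρ<τ (p⊆q⇒∣p∣≤∣q∣ τ⊆ρ))

inhabited : ∀ {n} {σ : Subset n} → 0 < ∣ σ ∣ → ∃[ x ] (x ∈ σ)
inhabited {n} {σ} 0<σ with larger⇒witness {τ = σ} {ρ = ∅} (subst (_< ∣ σ ∣) (sym (∣⊥∣≡0 n)) 0<σ)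
... | x , x∈σ , _ = x , x∈σ

⊆-sizes⇒≡ : ∀ {n} {ρ τ : Subset n} → ρ ⊆ τ → ∣ τ ∣ ≤ ∣ ρ ∣ → ρ ≡ τ
⊆-sizes⇒≡ {ρ = ρ} {τ} ρ⊆τ τ≤ρ with τ ⊆? ρ
... | yes τ⊆ρ = ⊆-antisym ρ⊆τ τ⊆ρ
... | no τ⊈ρ with ⊈⇒witness τ⊈ρ
... | x , x∈τ , x∉ρ = ⊥-elim (ℕ.<⇒≱ (p⊂q⇒∣p∣<∣q∣ (ρ⊆τ , x , x∈τ , x∉ρ)) τ≤ρ)

infixl 6 _+ₛ_
_+ₛ_ : ∀ {n} → Subset n → Fin n → Subset n
ρ +ₛ x = ρ ∪ ⁅ x ⁆

∈+ₛ-new : ∀ {n} {ρ : Subset n} {x} → x ∈ ρ +ₛ x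
∈+ₛ-new {x = x} = x∈p∪q⁺ (inj₂ (x∈⁅x⁆ x))

∈+ₛ-old : ∀ {n} {ρ : Subset n} {x z} → z ∈ ρ → z ∈ ρ +ₛ x
∈+ₛ-old z∈ρ = x∈p∪q⁺ (inj₁ z∈ρ)

∈+ₛ⁻ : ∀ {n} {ρ : Subset n} {x z} → z ∈ ρ +ₛ x → z ∈ ρ ⊎ z ≡ x
∈+ₛ⁻ {ρ = ρ} {x} z∈ with x∈p∪q⁻ ρ ⁅ x ⁆ z∈
... | inj₁ z∈ρ = inj₁ z∈ρ
... | inj₂ z∈x = inj₂ (x∈⁅y⁆⇒x≡y x z∈x)

∉+ₛ : ∀ {n} {ρ : Subset n} {x z} → z ∉ ρ → z ≢ x → z ∉ ρ +ₛ x
∉+ₛ z∉ρ z≢x z∈ with ∈+ₛ⁻ z∈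
... | inj₁ z∈ρ = z∉ρ z∈ρ
... | inj₂ z≡x = z≢x z≡x

+ₛ⊆ : ∀ {n} {ρ τ : Subset n} {x} → ρ ⊆ τ → x ∈ τ → ρ +ₛ x ⊆ τ
+ₛ⊆ ρ⊆τ x∈τ z∈ with ∈+ₛ⁻ z∈
... | inj₁ z∈ρ = ρ⊆τ z∈ρ
... | inj₂ refl = x∈τ

⁅⁆⊆ : ∀ {n} {v : Fin n} {τ} → v ∈ τ → ⁅ v ⁆ ⊆ τ
⁅⁆⊆ {v = v} v∈τ u∈⁅v⁆ = subst (_∈ _) (sym (x∈⁅y⁆⇒x≡y v u∈⁅v⁆)) v∈τ

∪⊆ : ∀ {n} {p q τ : Subset n} → p ⊆ τ → q ⊆ τ → p ∪ q ⊆ τ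
∪⊆ {p = p} {q} p⊆τ q⊆τ z∈ with x∈p∪q⁻ p q z∈
... | inj₁ z∈p = p⊆τ z∈p
... | inj₂ z∈q = q⊆τ z∈q

∣+ₛ∣ : ∀ {n} {ρ : Subset n} {x} → x ∉ ρ → ∣ ρ +ₛ x ∣ ≡ suc ∣ ρ ∣
∣+ₛ∣ {suc n} {false ∷ ρ} {zero} x∉ρ = cong suc (cong ∣_∣ (∪-identityʳ ρ))
∣+ₛ∣ {suc n} {true ∷ ρ} {zero} x∉ρ = ⊥-elim (x∉ρ here)
∣+ₛ∣ {suc n} {true ∷ ρ} {suc x} x∉ρ = cong suc (∣+ₛ∣ (λ x∈ρ → x∉ρ (there x∈ρ)))
∣+ₛ∣ {suc n} {false ∷ ρ} {suc x} x∉ρ = ∣+ₛ∣ (λ x∈ρ → x∉ρ (there x∈ρ))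

+ₛ-swap : ∀ {n} (ρ : Subset n) x y → ρ +ₛ x +ₛ y ≡ ρ +ₛ y +ₛ x
+ₛ-swap ρ x y = begin
  (ρ ∪ ⁅ x ⁆) ∪ ⁅ y ⁆  ≡⟨ ∪-assoc ρ ⁅ x ⁆ ⁅ y ⁆ ⟩
  ρ ∪ (⁅ x ⁆ ∪ ⁅ y ⁆)  ≡⟨ cong (ρ ∪_) (∪-comm ⁅ x ⁆ ⁅ y ⁆) ⟩
  ρ ∪ (⁅ y ⁆ ∪ ⁅ x ⁆)  ≡⟨ ∪-assoc ρ ⁅ y ⁆ ⁅ x ⁆ ⟨
  (ρ ∪ ⁅ y ⁆) ∪ ⁅ x ⁆  ∎
  where open ≡-Reasoning

∉-x : ∀ {n} {ρ : Subset n} {x} → x ∉ ρ - x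
∉-x {suc n} {b ∷ ρ} {zero} ()
∉-x {suc n} {b ∷ ρ} {suc x} (there x∈) = ∉-x x∈

∣-x∣ : ∀ {n} {ρ : Subset n} {x} → x ∈ ρ → suc ∣ ρ - x ∣ ≡ ∣ ρ ∣
∣-x∣ {suc n} {true ∷ ρ} {zero} here = cong suc (cong ∣_∣ (p─⊥≡p ρ))
∣-x∣ {suc n} {true ∷ ρ} {suc x} (there x∈ρ) = cong suc (∣-x∣ x∈ρ)
∣-x∣ {suc n} {false ∷ ρ} {suc x} (there x∈ρ) = ∣-x∣ x∈ρ

-x-y⊆-y : ∀ {n} {σ : Subset n} {x y} → σ - x - y ⊆ σ - y
-x-y⊆-y {σ = σ} {x} {y} z∈ = p─q⊆p (σ - y) ⁅ x ⁆ (subst (_ ∈_) (p─x─y≡p─y─x σ x y) z∈)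

∉-x⇒∉ : ∀ {n} {σ : Subset n} {x z} → z ∉ σ - x → z ≢ x → z ∉ σ
∉-x⇒∉ z∉σ-x z≢x z∈σ = z∉σ-x (x∈p∧x≢y⇒x∈p-y z∈σ z≢x)

sharedOutside? : ∀ {n} (σ τ τ' : Subset n) → ∃[ c ] (c ∈ τ × c ∈ τ' × c ∉ σ) ⊎ τ ∩ τ' ⊆ σ
sharedOutside? {n} σ τ τ' with any? {n = n} (λ c → c ∈? τ ×-dec (c ∈? τ' ×-dec ¬? (c ∈? σ)))
... | yes shared = inj₁ shared
... | no none = inj₂ common⊆σ
  where
  common⊆σ : τ ∩ τ' ⊆ σ
  common⊆σ {c} c∈τ∩τ' with c ∈? σ | x∈p∩q⁻ τ τ' c∈τ∩τ'
  ... | yes c∈σ | _ = c∈σ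
  ... | no c∉σ | c∈τ , c∈τ' = ⊥-elim (none (c , c∈τ , c∈τ' , c∉σ))

count : ∀ {n} {P : Subset n → Set} → Decidable P → ℕ
count {zero} P? with P? []
... | yes _ = 1
... | no _ = 0
count {suc n} P? = count (λ p → P? (inside ∷ p)) + count (λ p → P? (outside ∷ p))

count-mono : ∀ {n} {P Q : Subset n → Set} (P? : Decidable P) (Q? : Decidable Q) →
  (∀ {p} → P p → Q p) → count P? ≤ count Q?
count-mono {zero} P? Q? P⇒Q with P? [] | Q? []
... | yes _ | yes _ = ℕ.≤-refl
... | yes P[] | no ¬Q[] = ⊥-elim (¬Q[] (P⇒Q P[]))
... | no _ | _ = z≤n
count-mono {suc n} P? Q? P⇒Q =
  ℕ.+-mono-≤ (count-mono (λ p → P? (inside ∷ p)) (λ p → Q? (inside ∷ p)) P⇒Q)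
             (count-mono (λ p → P? (outside ∷ p)) (λ p → Q? (outside ∷ p)) P⇒Q)

count-strict : ∀ {n} {P Q : Subset n → Set} (P? : Decidable P) (Q? : Decidable Q) →
  (∀ {p} → P p → Q p) → (∃[ p ] (Q p × ¬ P p)) → count P? < count Q?
count-strict {zero} P? Q? P⇒Q ([] , Q[] , ¬P[]) with P? [] | Q? []
... | yes P[] | _ = ⊥-elim (¬P[] P[])
... | no _ | yes _ = ℕ.≤-refl
... | no _ | no ¬Q[] = ⊥-elim (¬Q[] Q[])
count-strict {suc n} P? Q? P⇒Q (inside ∷ p , new) =
  ℕ.+-mono-<-≤ (count-strict (λ p → P? (inside ∷ p)) (λ p → Q? (inside ∷ p)) P⇒Q (p , new))
               (count-mono (λ p → P? (outside ∷ p)) (λ p → Q? (outside ∷ p)) P⇒Q)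
count-strict {suc n} P? Q? P⇒Q (outside ∷ p , new) =
  ℕ.+-mono-≤-< (count-mono (λ p → P? (inside ∷ p)) (λ p → Q? (inside ∷ p)) P⇒Q)
               (count-strict (λ p → P? (outside ∷ p)) (λ p → Q? (outside ∷ p)) P⇒Q (p , new))

count≤2^n : ∀ {n} {P : Subset n → Set} (P? : Decidable P) → count P? ≤ 2 ^ n
count≤2^n {zero} P? with P? []
... | yes _ = ℕ.≤-refl
... | no _ = z≤n
count≤2^n {suc n} P? = begin
  count (λ p → P? (inside ∷ p)) + count (λ p → P? (outside ∷ p))
    ≤⟨ ℕ.+-mono-≤ (count≤2^n (λ p → P? (inside ∷ p))) (count≤2^n (λ p → P? (outside ∷ p))) ⟩
  2 ^ n + 2 ^ n  ≡⟨ cong (2 ^ n +_) (ℕ.+-identityʳ (2 ^ n)) ⟨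
  2 ^ suc n      ∎
  where open ℕ.≤-Reasoning

stabilises : ∀ {n} (P : ℕ → Subset n → Set) → (∀ k → Decidable (P k)) →
  (∀ k {p} → P k p → P (suc k) p) → ∃[ k ] (∀ {p} → P (suc k) p → P k p)
stabilises {n} P P? grow = search (suc (2 ^ n)) 0 (ℕ.m≤m+n (suc (2 ^ n)) _)
  where
  -- invariant: the remaining fuel exceeds the number of subsets not yet reached
  search : ∀ fuel k → 2 ^ n < fuel + count (P? k) → ∃[ k ] (∀ {p} → P (suc k) p → P k p)
  search zero k bound = ⊥-elim (ℕ.<⇒≱ bound (count≤2^n (P? k)))
  search (suc fuel) k bound with anySubset? (λ p → P? (suc k) p ×-dec ¬? (P? k p))
  ... | yes new = search fuel (suc k) (ℕ.<-≤-trans bound (begin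
          suc fuel + count (P? k)   ≡⟨ ℕ.+-suc fuel _ ⟨
          fuel + suc (count (P? k)) ≤⟨ ℕ.+-monoʳ-≤ fuel (count-strict (P? k) (P? (suc k)) (grow k) new) ⟩
          fuel + count (P? (suc k)) ∎))
    where open ℕ.≤-Reasoning
  ... | no none = k , stationary
    where
    stationary : ∀ {p} → P (suc k) p → P k p
    stationary {p} P₊p with P? k p
    ... | yes Pp = Pp
    ... | no ¬Pp = ⊥-elim (none (p , P₊p , ¬Pp))

FacetAbove : ∀ {n} → Complex n → Subset n → Set
FacetAbove Δ ρ = ∃[ τ ] (Facet Δ τ × ρ ⊆ τ)

-- every face lies in a facet, up to double negation: being a face is not
-- decidable, so no facet can be computed from a face alone
¬¬facetAbove : ∀ {n} (Δ : Complex n) {ρ} → Δ ρ → ¬ ¬ FacetAbove Δ ρ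
¬¬facetAbove Δ {ρ} = above ρ (⊃-wellFounded ρ)
  where
  above : ∀ ρ → Acc _⊃_ ρ → Δ ρ → ¬ ¬ FacetAbove Δ ρ
  above ρ (acc larger) Δρ noFacet = noFacet (ρ , (Δρ , maximal) , ⊆-refl)
    where
    maximal : ∀ ρ' → Δ ρ' → ρ ⊆ ρ' → ρ' ≡ ρ
    maximal ρ' Δρ' ρ⊆ρ' with ρ' ⊆? ρ
    ... | yes ρ'⊆ρ = ⊆-antisym ρ'⊆ρ ρ⊆ρ'
    ... | no ρ'⊈ρ = ⊥-elim (above ρ' (larger (ρ⊆ρ' , ⊈⇒witness ρ'⊈ρ)) Δρ'
            (λ { (τ , Fτ , ρ'⊆τ) → noFacet (τ , Fτ , ⊆-trans ρ⊆ρ' ρ'⊆τ) }))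

step-≢ : ∀ {n} {Δ : Complex n} {τ τ'} → StrongStep Δ τ τ' → τ ≢ τ'
step-≢ {τ = τ} (_ , _ , (_ , ∣τ∩τ∣<∣τ∣) , _) refl =
  ℕ.1+n≢n (trans (cong (λ ρ → suc ∣ ρ ∣) (sym (∩-idem τ))) ∣τ∩τ∣<∣τ∣)

step-size : ∀ {n} {Δ : Complex n} {τ τ'} → StrongStep Δ τ τ' → ∣ τ ∣ ≡ ∣ τ' ∣
step-size (_ , _ , (_ , e) , (_ , e')) = trans (sym e) e'

chain-size : ∀ {n} {Δ : Complex n} {τ τ'} → Star (StrongStep Δ) τ τ' → ∣ τ ∣ ≡ ∣ τ' ∣
chain-size ε = refl
chain-size (step ◅ chain) = trans (step-size step) (chain-size chain)

step-sym : ∀ {n} {Δ : Complex n} {τ τ'} → StrongStep Δ τ τ' → StrongStep Δ τ' τ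
step-sym {τ = τ} {τ'} (Fτ , Fτ' , c , c') =
  Fτ' , Fτ , subst (λ ρ → CodimOne ρ τ') (∩-comm τ τ') c' , subst (λ ρ → CodimOne ρ τ) (∩-comm τ τ') c

step-ridge : ∀ {n} {Δ : Complex n} {τ τ' y} → StrongStep Δ τ τ' → y ∈ τ → y ∉ τ' → τ - y ⊆ τ'
step-ridge {τ = τ} {τ'} {y} (_ , _ , (_ , ∣τ∩τ'∣) , _) y∈τ y∉τ' z∈ =
  p∩q⊆q τ τ' (subst (_ ∈_) (sym τ∩τ'≡τ-y) z∈)
  where
  τ∩τ'⊆τ-y : τ ∩ τ' ⊆ τ - y
  τ∩τ'⊆τ-y {z} z∈τ∩τ' with x∈p∩q⁻ τ τ' z∈τ∩τ'
  ... | z∈τ , z∈τ' = x∈p∧x≢y⇒x∈p-y z∈τ (λ { refl → y∉τ' z∈τ' })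
  τ∩τ'≡τ-y : τ ∩ τ' ≡ τ - y
  τ∩τ'≡τ-y = ⊆-sizes⇒≡ τ∩τ'⊆τ-y (ℕ.≤-reflexive (ℕ.suc-injective (trans (∣-x∣ y∈τ) (sym ∣τ∩τ'∣))))

module Pseudomanifold {n} {Δ : Complex n} {d : ℕ} (pm : IsPseudomanifold Δ d) where

  closed : IsSimplicialComplex Δ
  closed = proj₁ pm

  σ₀ : Subset n
  σ₀ = proj₁ (proj₁ (proj₁ (proj₂ pm)))

  Δσ₀ : Δ σ₀
  Δσ₀ = proj₁ (proj₂ (proj₁ (proj₁ (proj₂ pm))))

  ∣σ₀∣ : ∣ σ₀ ∣ ≡ d
  ∣σ₀∣ = proj₂ (proj₂ (proj₁ (proj₁ (proj₂ pm))))

  faceSize≤d : ∀ {σ} → Δ σ → ∣ σ ∣ ≤ d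
  faceSize≤d = proj₂ (proj₁ (proj₂ pm)) _

  stronglyConnected : ∀ {τ τ'} → Facet Δ τ → Facet Δ τ' → Star (StrongStep Δ) τ τ'
  stronglyConnected Fτ Fτ' = proj₂ (proj₂ (proj₁ (proj₂ (proj₂ pm))) _ _ Fτ Fτ')

  IsRidge : Subset n → Set
  IsRidge ρ = Δ ρ × suc ∣ ρ ∣ ≡ d

  ridgeInTwo : ∀ {ρ} → IsRidge ρ → InExactlyTwoFacets Δ ρ
  ridgeInTwo (Δρ , ∣ρ∣) = proj₂ (proj₂ (proj₂ pm)) _ Δρ ∣ρ∣

  full⇒facet : ∀ {τ} → Δ τ → d ≤ ∣ τ ∣ → Facet Δ τ
  full⇒facet Δτ d≤τ = Δτ , λ ρ Δρ τ⊆ρ → sym (⊆-sizes⇒≡ τ⊆ρ (ℕ.≤-trans (faceSize≤d Δρ) d≤τ))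

  σ₀-facet : Facet Δ σ₀
  σ₀-facet = full⇒facet Δσ₀ (ℕ.≤-reflexive (sym ∣σ₀∣))

  -- pure: by strong connectivity every facet has the size of σ₀
  facetSize : ∀ {τ} → Facet Δ τ → ∣ τ ∣ ≡ d
  facetSize Fτ = trans (sym (chain-size (stronglyConnected σ₀-facet Fτ))) ∣σ₀∣

  facet-⊆ : ∀ {F G} → Facet Δ F → Facet Δ G → F ⊆ G → F ≡ G
  facet-⊆ (_ , maximal) (ΔG , _) F⊆G = sym (maximal _ ΔG F⊆G)

  facet-x : ∀ {τ x} → Facet Δ τ → x ∈ τ → IsRidge (τ - x)
  facet-x {τ} Fτ x∈τ = closed _ τ (proj₁ Fτ) (p─q⊆p τ _) , trans (∣-x∣ x∈τ) (facetSize Fτ)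

  step-common : ∀ {τ τ'} → StrongStep Δ τ τ' → IsRidge (τ ∩ τ')
  step-common {τ} {τ'} (Fτ , _ , (_ , ∣τ∩τ'∣) , _) =
    closed _ τ (proj₁ Fτ) (p∩q⊆p τ τ') , trans ∣τ∩τ'∣ (facetSize Fτ)

  thirdFacet : ∀ {ρ A B C} → IsRidge ρ → Facet Δ A → Facet Δ B → Facet Δ C →
    ρ ⊆ A → ρ ⊆ B → ρ ⊆ C → A ≢ B → A ≢ C → B ≡ C
  thirdFacet ridge FA FB FC ρ⊆A ρ⊆B ρ⊆C A≢B A≢C
    with ridgeInTwo ridge
  ... | _ , _ , _ , _ , _ , _ , _ , oneOfTwo
    with oneOfTwo _ FA ρ⊆A | oneOfTwo _ FB ρ⊆B | oneOfTwo _ FC ρ⊆C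
  ... | inj₁ refl | inj₁ refl | _ = ⊥-elim (A≢B refl)
  ... | inj₂ refl | inj₂ refl | _ = ⊥-elim (A≢B refl)
  ... | inj₁ refl | _ | inj₁ refl = ⊥-elim (A≢C refl)
  ... | inj₂ refl | _ | inj₂ refl = ⊥-elim (A≢C refl)
  ... | inj₁ refl | inj₂ refl | inj₂ refl = refl
  ... | inj₂ refl | inj₁ refl | inj₁ refl = refl

  otherFacet : ∀ {ρ F} → IsRidge ρ → Facet Δ F → ρ ⊆ F → ∃[ G ] (Facet Δ G × ρ ⊆ G × G ≢ F)
  otherFacet {F = F} ridge FF ρ⊆F with ridgeInTwo ridge
  ... | τ₁ , τ₂ , τ₁≢τ₂ , Fτ₁ , Fτ₂ , ρ⊆τ₁ , ρ⊆τ₂ , _ with F ≟ₛ τ₁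
  ... | yes refl = τ₂ , Fτ₂ , ρ⊆τ₂ , λ τ₂≡τ₁ → τ₁≢τ₂ (sym τ₂≡τ₁)
  ... | no F≢τ₁ = τ₁ , Fτ₁ , ρ⊆τ₁ , λ τ₁≡F → F≢τ₁ (sym τ₁≡F)

  adjacent : ∀ {F G ρ} → Facet Δ F → Facet Δ G → F ≢ G → ρ ⊆ F → ρ ⊆ G → suc ∣ ρ ∣ ≡ d →
    StrongStep Δ F G
  adjacent {F} {G} {ρ} FF FG F≢G ρ⊆F ρ⊆G ∣ρ∣ =
    FF , FG , (p∩q⊆p F G , ∣F∩G∣≡ FF) , (p∩q⊆q F G , ∣F∩G∣≡ FG)
    where
    d≤ : d ≤ suc ∣ F ∩ G ∣
    d≤ = subst (_≤ suc ∣ F ∩ G ∣) ∣ρ∣ (s≤s (p⊆q⇒∣p∣≤∣q∣ (λ z∈ρ → x∈p∩q⁺ (ρ⊆F z∈ρ , ρ⊆G z∈ρ))))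
    ≤d : suc ∣ F ∩ G ∣ ≤ d
    ≤d with ⊈⇒witness (λ F⊆F∩G → F≢G (facet-⊆ FF FG (λ z∈F → p∩q⊆q F G (F⊆F∩G z∈F))))
    ... | x , x∈F , x∉F∩G =
      subst (suc ∣ F ∩ G ∣ ≤_) (facetSize FF) (p⊂q⇒∣p∣<∣q∣ (p∩q⊆p F G , x , x∈F , x∉F∩G))
    ∣F∩G∣≡ : ∀ {H} → Facet Δ H → suc ∣ F ∩ G ∣ ≡ ∣ H ∣
    ∣F∩G∣≡ FH = trans (ℕ.≤-antisym ≤d d≤) (sym (facetSize FH))

-- Since faces cannot be
-- searched for, we compute the list of all facets: starting from σ₀ and
-- repeatedly adding the facets through the ridges of those found so far, the
-- set of found facets becomes stationary; by strong connectivity it then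
-- contains every facet, and a facet through the vertex can be looked up.

module FacetEnumeration {n} {Δ : Complex n} {d : ℕ} (pm : IsPseudomanifold Δ d) where
  open Pseudomanifold pm

  KnownFacet : Set
  KnownFacet = Σ (Subset n) (Facet Δ)

  Listed : Subset n → List KnownFacet → Set
  Listed τ L = Any (λ F → τ ≡ proj₁ F) L

  facetsAcross : ∀ {τ} → Facet Δ τ → Fin n → List KnownFacet
  facetsAcross {τ} Fτ x with x ∈? τ
  ... | no _ = []
  ... | yes x∈τ with ridgeInTwo (facet-x Fτ x∈τ)
  ...   | τ₁ , τ₂ , _ , Fτ₁ , Fτ₂ , _ = (τ₁ , Fτ₁) ∷ (τ₂ , Fτ₂) ∷ []

  neighbours : KnownFacet → List KnownFacet
  neighbours (τ , Fτ) = concatMap (facetsAcross Fτ) (allFin n)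

  neighbours-complete : ∀ F {τ'} → StrongStep Δ (proj₁ F) τ' → Listed τ' (neighbours F)
  neighbours-complete (τ , Fτ) {τ'} step with ⊈⇒witness (λ τ⊆τ' → step-≢ step (facet-⊆ Fτ (proj₁ (proj₂ step)) τ⊆τ'))
  ... | x , x∈τ , x∉τ' = concat⁺ (map⁺ (lose (∈-allFin x) across))
    where
    across : Listed τ' (facetsAcross Fτ x)
    across with x ∈? τ
    ... | no x∉τ = ⊥-elim (x∉τ x∈τ)
    ... | yes x∈τ′ with ridgeInTwo (facet-x Fτ x∈τ′)
    ...   | _ , _ , _ , _ , _ , _ , _ , oneOfTwo with oneOfTwo τ' (proj₁ (proj₂ step)) (step-ridge step x∈τ x∉τ')
    ...     | inj₁ refl = here refl
    ...     | inj₂ refl = there (here refl)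

  found : ℕ → List KnownFacet
  found zero = (σ₀ , σ₀-facet) ∷ []
  found (suc k) = found k ++ concatMap neighbours (found k)

  Found : ℕ → Subset n → Set
  Found k τ = Listed τ (found k)

  found-next : ∀ {k τ τ'} → Found k τ → StrongStep Δ τ τ' → Found (suc k) τ'
  found-next {k} {τ' = τ'} τ-found step =
    ++⁺ʳ (found k) (concat⁺ (map⁺ (Any.map (λ { refl → neighbours-complete _ step }) τ-found)))

  stationary : ∃[ k ] (∀ {τ} → Found (suc k) τ → Found k τ)
  stationary = stabilises Found (λ k τ → Any.any? (λ F → τ ≟ₛ proj₁ F) (found k)) (λ k → ++⁺ˡ)

  σ₀-found : ∀ k → Found k σ₀
  σ₀-found zero = here refl
  σ₀-found (suc k) = ++⁺ˡ (σ₀-found k)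

  all-found : ∀ {τ} → Facet Δ τ → Found (proj₁ stationary) τ
  all-found Fτ = along (σ₀-found (proj₁ stationary)) (stronglyConnected σ₀-facet Fτ)
    where
    along : ∀ {τ τ'} → Found (proj₁ stationary) τ → Star (StrongStep Δ) τ τ' → Found (proj₁ stationary) τ'
    along τ-found ε = τ-found
    along τ-found (step ◅ chain) = along (proj₂ stationary (found-next {proj₁ stationary} τ-found step)) chain

  -- look up a facet containing u; none being listed would contradict the
  -- double-negated existence of a facet above the face {u}
  vertexInFacet : ∀ {u} → IsVertex Δ u → ∃[ τ ] (Facet Δ τ × u ∈ τ)
  vertexInFacet {u} vertex with Any.any? (λ F → u ∈? proj₁ F) (found (proj₁ stationary))
  ... | yes inListed with Any.satisfied inListed
  ...   | (τ , Fτ) , u∈τ = τ , Fτ , u∈τ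
  vertexInFacet {u} vertex | no notListed = ⊥-elim (¬¬facetAbove Δ vertex λ { (τ , Fτ , u⊆τ) →
    notListed (Any.map (λ { refl → u⊆τ (x∈⁅x⁆ u) }) (all-found Fτ)) })

-- A walk that never backtracks in a finite graph of maximum degree two
-- returns to its start, visiting distinct vertices until then.

searchBelow : ∀ {P : ℕ → Set} → Decidable P → ∀ b →
  (∀ {i} → i < b → ¬ P i) ⊎ ∃[ k ] (P k × (∀ {i} → i < k → ¬ P i))
searchBelow P? zero = inj₁ (λ ())
searchBelow {P} P? (suc b) with searchBelow P? b
... | inj₂ least = inj₂ least
... | inj₁ none with P? b
...   | yes Pb = inj₂ (b , Pb , none)
...   | no ¬Pb = inj₁ (λ i<1+b → extend (ℕ.m<1+n⇒m<n∨m≡n i<1+b))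
  where
  extend : ∀ {i} → i < b ⊎ i ≡ b → ¬ P i
  extend (inj₁ i<b) = none i<b
  extend (inj₂ refl) = ¬Pb

leastWitness : ∀ {P : ℕ → Set} → Decidable P → ∀ {j} → P j → ∃[ k ] (P k × (∀ {i} → i < k → ¬ P i))
leastWitness P? {j} Pj with searchBelow P? (suc j)
... | inj₁ none = ⊥-elim (none (ℕ.n<1+n j) Pj)
... | inj₂ least = least

module NonBacktrackingWalk {n} (Adj : Fin n → Fin n → Set)
  (adj-sym : ∀ {a b} → Adj a b → Adj b a) (adj-irrefl : ∀ {a} → ¬ Adj a a)
  (degree≤2 : ∀ {c a b e} → Adj c a → Adj c b → Adj c e → a ≢ b → a ≢ e → b ≡ e)
  (y : ℕ → Fin n) (y-adj : ∀ i → Adj (y i) (y (suc i)))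
  (no-backtrack : ∀ i → y (suc (suc i)) ≢ y i) where

  Repeat : ℕ → Set
  Repeat j = ∃[ i ] (i < j × y i ≡ y j)

  Repeat? : Decidable Repeat
  Repeat? j = map′ (λ (i , yi≡yj) → toℕ i , toℕ<n i , yi≡yj)
                   (λ (i , i<j , yi≡yj) → fromℕ< i<j , trans (cong y (toℕ-fromℕ< i<j)) yi≡yj)
                   (any? (λ (i : Fin j) → y (toℕ i) ≟ᶠ y j))

  someRepeat : Repeat (toℕ (proj₁ (proj₂ (pigeonhole (ℕ.n<1+n n) (λ i → y (toℕ i))))))
  someRepeat with pigeonhole (ℕ.n<1+n n) (λ i → y (toℕ i))
  ... | i , j , i<j , yi≡yj = toℕ i , i<j , yi≡yj

  Minimal : ℕ → Set
  Minimal j = ∀ {j'} → j' < j → ¬ Repeat j'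

  distinct : ∀ {j k k'} → Minimal j → k < j → k' < j → y k ≡ y k' → k ≡ k'
  distinct {k = k} {k'} first k<j k'<j yk≡yk' with ℕ.<-cmp k k'
  ... | tri< k<k' _ _ = ⊥-elim (first k'<j (k , k<k' , yk≡yk'))
  ... | tri≈ _ k≡k' _ = k≡k'
  ... | tri> _ _ k'<k = ⊥-elim (first k<j (k' , k'<k , sym yk≡yk'))

  -- if the first repetition is y (suc a) = y (suc j'), the vertex y (suc a)
  -- has neighbours y a, y (a + 2) and y j', so two of them agree
  throughSame : ∀ {a j'} → Minimal (suc j') → a < j' → y (suc a) ≡ y (suc j') → y (suc (suc a)) ≡ y j'
  throughSame {a} {j'} first a<j' ya≡yj = degree≤2 (adj-sym (y-adj a)) (y-adj (suc a))
    (subst (λ z → Adj z (y j')) (sym ya≡yj) (adj-sym (y-adj j')))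
    (λ e → no-backtrack a (sym e))
    (λ e → first (ℕ.n<1+n j') (a , a<j' , e))

  repeatsStart : ∀ {i j} → Minimal j → i < j → y i ≡ y j → i ≡ 0
  repeatsStart {zero} _ _ _ = refl
  repeatsStart {suc a} {suc j'} first a<j' yi≡yj with ℕ.<-cmp (suc (suc a)) j'
  ... | tri< a+2<j' _ _ =
    ⊥-elim (first (ℕ.n<1+n j') (suc (suc a) , a+2<j' , throughSame first (s≤s⁻¹ a<j') yi≡yj))
  ... | tri≈ _ refl _ = ⊥-elim (no-backtrack (suc a) (sym yi≡yj))
  ... | tri> _ _ j'<a+2 with ℕ.≤-antisym (s≤s⁻¹ j'<a+2) (s≤s⁻¹ a<j')
  ...   | refl = ⊥-elim (adj-irrefl (subst (Adj (y (suc a))) (sym yi≡yj) (y-adj (suc a))))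

  closes : ∃[ m ] (y (suc (suc m)) ≡ y 0 × (∀ {k k'} → k ≤ suc m → k' ≤ suc m → y k ≡ y k' → k ≡ k'))
  closes with leastWitness Repeat? someRepeat
  ... | j , (i , i<j , yi≡yj) , first with repeatsStart first i<j yi≡yj
  ...   | refl with j
  ...     | suc zero = ⊥-elim (adj-irrefl (subst (Adj (y 0)) (sym yi≡yj) (y-adj 0)))
  ...     | suc (suc m) = m , sym yi≡yj , λ k≤ k'≤ → distinct first (s≤s k≤) (s≤s k'≤)

-- Strong chains whose consecutive facets share a vertex outside σ: exactly
-- what is needed to build a Δ-strong walk in 𝒢(Δ) ∖ σ.

AvoidingStep : ∀ {n} → Complex n → Subset n → Subset n → Subset n → Set
AvoidingStep Δ σ τ τ' = StrongStep Δ τ τ' × ∃[ c ] (c ∈ τ × c ∈ τ' × c ∉ σ)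

AvoidingChain : ∀ {n} → Complex n → Subset n → Subset n → Subset n → Set
AvoidingChain Δ σ = Star (AvoidingStep Δ σ)

-- The facets through a face κ of size d - 2 form a cycle: its link is a
-- graph in which every vertex has exactly two neighbours.

module Link {n} {Δ : Complex n} {d : ℕ} (pm : IsPseudomanifold Δ d)
            (κ : Subset n) (∣κ∣ : suc (suc ∣ κ ∣) ≡ d) where
  open Pseudomanifold pm

  -- p and c are adjacent in the link of κ
  Adj : Fin n → Fin n → Set
  Adj p c = p ∉ κ × c ∉ κ × p ≢ c × Facet Δ (κ +ₛ p +ₛ c)

  third : ∀ {c a z} → z ∈ κ +ₛ c +ₛ a → z ∉ κ → z ≢ c → z ≡ a
  third z∈ z∉κ z≢c with ∈+ₛ⁻ z∈
  ... | inj₂ z≡a = z≡a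
  ... | inj₁ z∈κc with ∈+ₛ⁻ z∈κc
  ...   | inj₁ z∈κ = ⊥-elim (z∉κ z∈κ)
  ...   | inj₂ z≡c = ⊥-elim (z≢c z≡c)

  ∣κc∣ : ∀ {c} → c ∉ κ → suc ∣ κ +ₛ c ∣ ≡ d
  ∣κc∣ c∉κ = trans (cong suc (∣+ₛ∣ c∉κ)) ∣κ∣

  ∣κca∣ : ∀ {c a} → c ∉ κ → a ∉ κ → a ≢ c → ∣ κ +ₛ c +ₛ a ∣ ≡ d
  ∣κca∣ c∉κ a∉κ a≢c = trans (∣+ₛ∣ (∉+ₛ a∉κ a≢c)) (∣κc∣ c∉κ)

  κc⊆κpc : ∀ {p c} → κ +ₛ c ⊆ κ +ₛ p +ₛ c
  κc⊆κpc {p} {c} = subst (κ +ₛ c ⊆_) (+ₛ-swap κ c p) (p⊆p∪q ⁅ p ⁆)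

  adj-sym : ∀ {p c} → Adj p c → Adj c p
  adj-sym {p} {c} (p∉κ , c∉κ , p≢c , F) = c∉κ , p∉κ , (λ e → p≢c (sym e)) , subst (Facet Δ) (+ₛ-swap κ p c) F

  adj-irrefl : ∀ {p} → ¬ Adj p p
  adj-irrefl (_ , _ , p≢p , _) = p≢p refl

  asLinkEdge : ∀ {τ p c} → Facet Δ τ → κ ⊆ τ → p ∈ τ → c ∈ τ → p ∉ κ → c ∉ κ → p ≢ c →
    Adj p c × κ +ₛ p +ₛ c ≡ τ
  asLinkEdge {τ} Fτ κ⊆τ p∈τ c∈τ p∉κ c∉κ p≢c = (p∉κ , c∉κ , p≢c , Fκpc) , facet-⊆ Fκpc Fτ κpc⊆τ
    where
    κpc⊆τ = +ₛ⊆ (+ₛ⊆ κ⊆τ p∈τ) c∈τ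
    Fκpc = full⇒facet (closed _ τ (proj₁ Fτ) κpc⊆τ)
                      (ℕ.≤-reflexive (sym (∣κca∣ p∉κ c∉κ (λ e → p≢c (sym e)))))

  -- the ridge κ + c lies in at most two facets
  degree≤2 : ∀ {c a b e} → Adj c a → Adj c b → Adj c e → a ≢ b → a ≢ e → b ≡ e
  degree≤2 {c} {a} {b} {e} (c∉κ , a∉κ , c≢a , Fa) (_ , b∉κ , c≢b , Fb) (_ , e∉κ , c≢e , Fe) a≢b a≢e =
    sym (third (subst (e ∈_) (sym κcb≡κce) ∈+ₛ-new) e∉κ (λ e≡c → c≢e (sym e≡c)))
    where
    ridge : IsRidge (κ +ₛ c)
    ridge = closed _ _ (proj₁ Fa) (p⊆p∪q _) , ∣κc∣ c∉κ
    distinctFacets : ∀ {b'} → a ≢ b' → b' ∉ κ → b' ≢ c → κ +ₛ c +ₛ a ≢ κ +ₛ c +ₛ b'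
    distinctFacets a≢b' b'∉κ b'≢c eq = a≢b' (sym (third (subst (_ ∈_) (sym eq) ∈+ₛ-new) b'∉κ b'≢c))
    κcb≡κce : κ +ₛ c +ₛ b ≡ κ +ₛ c +ₛ e
    κcb≡κce = thirdFacet ridge Fa Fb Fe (p⊆p∪q _) (p⊆p∪q _) (p⊆p∪q _)
      (distinctFacets a≢b b∉κ (λ b≡c → c≢b (sym b≡c))) (distinctFacets a≢e e∉κ (λ e≡c → c≢e (sym e≡c)))

  -- every vertex of the link has a second neighbour: the ridge κ + c lies
  -- in a facet besides κ + p + c
  next : ∀ {p c} → Adj p c → ∃[ z ] (Adj c z × z ≢ p)
  next {p} {c} (_ , c∉κ , _ , F) with otherFacet (closed _ _ (proj₁ F) κc⊆κpc , ∣κc∣ c∉κ) F κc⊆κpc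
  ... | G , FG , κc⊆G , G≢F
    with larger⇒witness {τ = G} {ρ = κ +ₛ c} (subst (∣ κ +ₛ c ∣ <_) (sym (facetSize FG)) (ℕ.≤-reflexive (∣κc∣ c∉κ)))
  ... | z , z∈G , z∉κc
    with asLinkEdge FG (λ w∈κ → κc⊆G (∈+ₛ-old w∈κ)) (κc⊆G ∈+ₛ-new) z∈G c∉κ
                    (λ z∈κ → z∉κc (∈+ₛ-old z∈κ)) (λ { refl → z∉κc ∈+ₛ-new })
  ... | c~z , κcz≡G = z , c~z , λ { refl → G≢F (trans (sym κcz≡G) (sym (+ₛ-swap κ p c))) }

  -- a vertex of the link together with the previously visited one
  Position : Set
  Position = ∃[ p ] ∃[ c ] Adj p c

  advance : Position → Position
  advance s = proj₁ (proj₂ s) , proj₁ (next (proj₂ (proj₂ s))) , proj₁ (proj₂ (next (proj₂ (proj₂ s))))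

  module Rotation {x a} (x~a : Adj x a) where

    -- abstract: only the listed properties of the walk are used, and
    -- unfolding it would make type checking expensive
    abstract
      position : ℕ → Position
      position zero = x , a , x~a
      position (suc i) = advance (position i)

      y : ℕ → Fin n
      y i = proj₁ (position i)

      y-start : y 0 ≡ x
      y-start = refl

      y-second : y 1 ≡ a
      y-second = refl

      y-adj : ∀ i → Adj (y i) (y (suc i))
      y-adj i = proj₂ (proj₂ (position i))

      no-backtrack : ∀ i → y (suc (suc i)) ≢ y i
      no-backtrack i = proj₂ (proj₂ (next (y-adj i)))

    open NonBacktrackingWalk Adj adj-sym adj-irrefl degree≤2 y y-adj no-backtrack using (closes)

    -- the link is the cycle y 0 = x, y 1 = a, …, y (period + 1), y (period + 2) = x
    period : ℕ
    period = proj₁ closes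

    returns : y (suc (suc period)) ≡ x
    returns = trans (proj₁ (proj₂ closes)) y-start

    distinct : ∀ {k k'} → k ≤ suc period → k' ≤ suc period → y k ≡ y k' → k ≡ k'
    distinct = proj₂ (proj₂ closes)

    lastNeighbour : ∀ {b} → Adj x b → b ≢ a → b ≡ y (suc period)
    lastNeighbour x~b b≢a = degree≤2 x~a x~b x~last (λ a≡b → b≢a (sym a≡b)) a≢last
      where
      x~last : Adj x (y (suc period))
      x~last = subst (λ z → Adj z (y (suc period))) returns (adj-sym (y-adj (suc period)))
      a≢last : a ≢ y (suc period)
      a≢last a≡last = no-backtrack 0 (trans (subst (λ k → y (suc (suc k)) ≡ x) period≡0 returns) (sym y-start))
        where
        period≡0 : period ≡ 0
        period≡0 = sym (ℕ.suc-injective (distinct (s≤s z≤n) ℕ.≤-refl (trans y-second a≡last)))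

    ≢start : ∀ {i} → i ≤ period → y (suc i) ≢ x
    ≢start i≤period e = ℕ.1+n≢0 (distinct (s≤s i≤period) z≤n (trans e (sym y-start)))

    facetAt : ℕ → Subset n
    facetAt i = κ +ₛ y i +ₛ y (suc i)

    -- consecutive facets around κ meet in the ridge κ + y (i + 1)
    turn : ∀ {σ} i → y (suc i) ∉ σ → AvoidingStep Δ σ (facetAt i) (facetAt (suc i))
    turn i y∉σ with y-adj i | y-adj (suc i)
    ... | yi∉κ , yi+1∉κ , yi≢yi+1 , Fi | _ , _ , _ , Fi+1 =
      adjacent Fi Fi+1 Fi≢Fi+1 κc⊆κpc (p⊆p∪q _) (∣κc∣ yi+1∉κ) ,
      y (suc i) , ∈+ₛ-new , ∈+ₛ-old ∈+ₛ-new , y∉σ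
      where
      Fi≢Fi+1 : facetAt i ≢ facetAt (suc i)
      Fi≢Fi+1 eq = no-backtrack i (sym (third (subst (y i ∈_) eq (∈+ₛ-old ∈+ₛ-new)) yi∉κ yi≢yi+1))

    around : ∀ {σ} k → (∀ {i} → i < k → y (suc i) ∉ σ) → AvoidingChain Δ σ (facetAt 0) (facetAt k)
    around zero _ = ε
    around (suc k) avoid = around k (λ i<k → avoid (ℕ.m<n⇒m<1+n i<k)) ◅◅ (turn k (avoid (ℕ.n<1+n k)) ◅ ε)

module Detours {n} {Δ : Complex n} {d : ℕ} (2≤d : 2 ≤ d) (pm : IsPseudomanifold Δ d) where
  open Pseudomanifold pm

  -- a step through the ridge σ = τ ∩ τ' (which is nonempty as d ≥ 2):
  -- rotate around κ = σ - x for a vertex x of σ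
  aroundRidge : ∀ {τ τ'} → StrongStep Δ τ τ' → AvoidingChain Δ (τ ∩ τ') τ τ'
  aroundRidge {τ} {τ'} step@(Fτ , Fτ' , (_ , ∣σ∣<∣τ∣) , (_ , ∣σ∣<∣τ'∣))
    with inhabited {σ = τ ∩ τ'} (s≤s⁻¹ (subst (2 ≤_) (sym (proj₂ (step-common step))) 2≤d))
       | larger⇒witness {τ = τ} {ρ = τ ∩ τ'} (ℕ.≤-reflexive ∣σ∣<∣τ∣)
       | larger⇒witness {τ = τ'} {ρ = τ ∩ τ'} (ℕ.≤-reflexive ∣σ∣<∣τ'∣)
  ... | x , x∈σ | a , a∈τ , a∉σ | b , b∈τ' , b∉σ =
    subst₂ (AvoidingChain Δ σ) κxa≡τ last≡τ' (around (suc period) avoidsσ)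
    where
    σ = τ ∩ τ'
    κ = σ - x
    open Link pm κ (trans (cong suc (∣-x∣ x∈σ)) (proj₂ (step-common step)))
    κ⊆σ : κ ⊆ σ
    κ⊆σ = p─q⊆p σ ⁅ x ⁆
    ∉σ⇒∉κ : ∀ {z} → z ∉ σ → z ∉ κ
    ∉σ⇒∉κ z∉σ z∈κ = z∉σ (κ⊆σ z∈κ)
    x≢ : ∀ {z} → z ∉ σ → x ≢ z
    x≢ z∉σ refl = z∉σ x∈σ
    edge-xa = asLinkEdge Fτ (λ z∈κ → p∩q⊆p τ τ' (κ⊆σ z∈κ)) (p∩q⊆p τ τ' x∈σ) a∈τ ∉-x (∉σ⇒∉κ a∉σ) (x≢ a∉σ)
    edge-xb = asLinkEdge Fτ' (λ z∈κ → p∩q⊆q τ τ' (κ⊆σ z∈κ)) (p∩q⊆q τ τ' x∈σ) b∈τ' ∉-x (∉σ⇒∉κ b∉σ) (x≢ b∉σ)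
    open Rotation (proj₁ edge-xa)
    κxa≡τ : facetAt 0 ≡ τ
    κxa≡τ = trans (cong₂ (λ u v → κ +ₛ u +ₛ v) y-start y-second) (proj₂ edge-xa)
    b≡last : b ≡ y (suc period)
    b≡last = lastNeighbour (proj₁ edge-xb) λ { refl → step-≢ step (trans (sym (proj₂ edge-xa)) (proj₂ edge-xb)) }
    last≡τ' : facetAt (suc period) ≡ τ'
    last≡τ' = trans (cong₂ (λ u v → κ +ₛ u +ₛ v) (sym b≡last) returns) (trans (+ₛ-swap κ b x) (proj₂ edge-xb))
    avoidsσ : ∀ {i} → i < suc period → y (suc i) ∉ σ
    avoidsσ {i} i<1+period = ∉-x⇒∉ (proj₁ (y-adj (suc i))) (≢start (s≤s⁻¹ i<1+period))

  -- the vertices of a facet σ missing from two different neighbours τ, τ₂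
  -- are different, or the ridge σ - x would lie in the three facets σ, τ, τ₂
  missing-≢ : ∀ {σ τ τ₂ x y} → Facet Δ σ → StrongStep Δ τ σ → StrongStep Δ σ τ₂ → τ ≢ τ₂ →
    x ∈ σ → x ∉ τ₂ → y ∉ τ → x ≢ y
  missing-≢ {σ} {x = x} Fσ step₁ step₂ τ≢τ₂ x∈σ x∉τ₂ x∉τ refl =
    τ≢τ₂ (thirdFacet (facet-x Fσ x∈σ) Fσ (proj₁ step₁) (proj₁ (proj₂ step₂)) (p─q⊆p σ ⁅ x ⁆)
            (step-ridge (step-sym step₁) x∈σ x∉τ) (step-ridge step₂ x∈σ x∉τ₂)
            (λ e → step-≢ step₁ (sym e)) (step-≢ step₂))

  -- passing through the facet σ from τ to τ₂ ≠ τ: with y the vertex of σ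
  -- missing in τ and x the one missing in τ₂, rotate around κ = σ - x - y;
  -- the cycle runs τ = κ + x + a, …, τ₂ = κ + _ + y, σ = κ + y + x
  aroundFacet : ∀ {σ τ τ₂} → Facet Δ σ → StrongStep Δ τ σ → StrongStep Δ σ τ₂ → τ ≢ τ₂ →
    AvoidingChain Δ σ τ τ₂
  aroundFacet {σ} {τ} {τ₂} Fσ step₁ step₂ τ≢τ₂
    with ⊈⇒witness (λ σ⊆τ → step-≢ step₁ (sym (facet-⊆ Fσ (proj₁ step₁) σ⊆τ)))
       | ⊈⇒witness (λ σ⊆τ₂ → step-≢ step₂ (facet-⊆ Fσ (proj₁ (proj₂ step₂)) σ⊆τ₂))
       | ⊈⇒witness (λ τ⊆σ → step-≢ step₁ (facet-⊆ (proj₁ step₁) Fσ τ⊆σ))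
  ... | y' , y'∈σ , y'∉τ | x , x∈σ , x∉τ₂ | a , a∈τ , a∉σ =
    subst₂ (AvoidingChain Δ σ) κxa≡τ (sym τ₂≡before) (around period avoidsσ)
    where
    σ-y'⊆τ : σ - y' ⊆ τ
    σ-y'⊆τ = step-ridge (step-sym step₁) y'∈σ y'∉τ
    σ-x⊆τ₂ : σ - x ⊆ τ₂
    σ-x⊆τ₂ = step-ridge step₂ x∈σ x∉τ₂
    x≢y' = missing-≢ Fσ step₁ step₂ τ≢τ₂ x∈σ x∉τ₂ y'∉τ
    y'∈σ-x : y' ∈ σ - x
    y'∈σ-x = x∈p∧x≢y⇒x∈p-y y'∈σ (λ e → x≢y' (sym e))
    κ = σ - x - y'
    open Link pm κ (trans (cong suc (∣-x∣ y'∈σ-x)) (trans (∣-x∣ x∈σ) (facetSize Fσ)))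
    κ⊆σ-x : κ ⊆ σ - x
    κ⊆σ-x = p─q⊆p (σ - x) ⁅ y' ⁆
    κ⊆σ : κ ⊆ σ
    κ⊆σ z∈κ = p─q⊆p σ ⁅ x ⁆ (κ⊆σ-x z∈κ)
    x∉κ : x ∉ κ
    x∉κ x∈κ = ∉-x (κ⊆σ-x x∈κ)
    edge-xa = asLinkEdge (proj₁ step₁) (λ z∈κ → σ-y'⊆τ (-x-y⊆-y z∈κ)) (σ-y'⊆τ (x∈p∧x≢y⇒x∈p-y x∈σ x≢y'))
                a∈τ x∉κ (λ a∈κ → a∉σ (κ⊆σ a∈κ)) (λ { refl → a∉σ x∈σ })
    edge-xy' = asLinkEdge Fσ κ⊆σ x∈σ y'∈σ x∉κ ∉-x x≢y'
    open Rotation (proj₁ edge-xa)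
    κxa≡τ : facetAt 0 ≡ τ
    κxa≡τ = trans (cong₂ (λ u v → κ +ₛ u +ₛ v) y-start y-second) (proj₂ edge-xa)
    y'≡last : y' ≡ y (suc period)
    y'≡last = lastNeighbour (proj₁ edge-xy') λ { refl → a∉σ y'∈σ }
    x≢y-period : x ≢ y period
    x≢y-period x≡y = a∉σ (subst (_∈ σ) y'≡a y'∈σ)
      where
      period≡0 : period ≡ 0
      period≡0 = sym (distinct z≤n (ℕ.n≤1+n period) (trans y-start x≡y))
      y'≡a : y' ≡ a
      y'≡a = trans y'≡last (trans (cong (λ k → y (suc k)) period≡0) y-second)
    -- the facet before σ on the cycle is the other facet through σ - x
    τ₂≡before : τ₂ ≡ facetAt period
    τ₂≡before = thirdFacet ridge Fσ (proj₁ (proj₂ step₂)) (proj₂ (proj₂ (proj₂ (y-adj period))))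
      (+ₛ⊆ κ⊆σ y'∈σ) (+ₛ⊆ (λ z∈κ → σ-x⊆τ₂ (κ⊆σ-x z∈κ)) (σ-x⊆τ₂ y'∈σ-x))
      (subst (λ c → κ +ₛ y' ⊆ κ +ₛ y period +ₛ c) y'≡last κc⊆κpc)
      (step-≢ step₂)
      (λ σ≡before → x≢y' (trans (third (subst (x ∈_) σ≡before x∈σ) x∉κ x≢y-period) (sym y'≡last)))
      where ridge = closed _ σ (proj₁ Fσ) (+ₛ⊆ κ⊆σ y'∈σ) , ∣κc∣ ∉-x
    avoidsσ : ∀ {i} → i < period → y (suc i) ∉ σ
    avoidsσ {i} i<period = ∉-x⇒∉ (∉-x⇒∉ (proj₁ (y-adj (suc i))) ≢y') (≢start (ℕ.<⇒≤ i<period))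
      where
      ≢y' : y (suc i) ≢ y'
      ≢y' e = ℕ.<⇒≢ i<period (ℕ.suc-injective (distinct (s≤s (ℕ.<⇒≤ i<period)) ℕ.≤-refl (trans e y'≡last)))

  -- for |σ| < d, every strong chain becomes one avoiding σ: a step whose
  -- facets meet only inside σ crosses the ridge σ itself
  avoidSmall : ∀ {σ τ τ'} → ∣ σ ∣ < d → Star (StrongStep Δ) τ τ' → AvoidingChain Δ σ τ τ'
  avoidSmall σ<d ε = ε
  avoidSmall {σ} {τ} σ<d (_◅_ {j = τ₁} step chain) with sharedOutside? σ τ τ₁
  ... | inj₁ shared = (step , shared) ◅ avoidSmall σ<d chain
  ... | inj₂ common⊆σ = subst (λ ρ → AvoidingChain Δ ρ τ τ₁) common≡σ (aroundRidge step) ◅◅ avoidSmall σ<d chain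
    where
    common≡σ : τ ∩ τ₁ ≡ σ
    common≡σ = ⊆-sizes⇒≡ common⊆σ (s≤s⁻¹ (subst (suc ∣ σ ∣ ≤_) (sym (proj₂ (step-common step))) σ<d))

  -- for a facet σ, every strong chain between facets other than σ becomes
  -- one avoiding σ: a step through σ is replaced by a detour around it, and
  -- any other step meets outside σ since no ridge lies in three facets
  avoidFacet : ∀ {σ τ τ'} → Facet Δ σ → Star (StrongStep Δ) τ τ' → τ ≢ σ → τ' ≢ σ → AvoidingChain Δ σ τ τ'
  avoidFacet Fσ ε _ _ = ε
  avoidFacet {σ} {τ} Fσ (_◅_ {j = τ₁} step chain) τ≢σ τ'≢σ with τ₁ ≟ₛ σ
  ... | no τ₁≢σ with sharedOutside? σ τ τ₁
  ...   | inj₁ shared = (step , shared) ◅ avoidFacet Fσ chain τ₁≢σ τ'≢σ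
  ...   | inj₂ common⊆σ = ⊥-elim (τ₁≢σ (thirdFacet (step-common step) (proj₁ step) (proj₁ (proj₂ step)) Fσ
                            (p∩q⊆p τ τ₁) (p∩q⊆q τ τ₁) common⊆σ (step-≢ step) τ≢σ))
  avoidFacet Fσ (step ◅ ε) _ τ'≢σ | yes refl = ⊥-elim (τ'≢σ refl)
  avoidFacet {τ = τ} Fσ (step ◅ (_◅_ {j = τ₂} step₂ chain)) τ≢σ τ'≢σ | yes refl with τ ≟ₛ τ₂
  ... | yes refl = avoidFacet Fσ chain τ≢σ τ'≢σ
  ... | no τ≢τ₂ = aroundFacet Fσ step step₂ τ≢τ₂ ◅◅ avoidFacet Fσ chain (λ e → step-≢ step₂ (sym e)) τ'≢σ

-- At a shared vertex v the incoming and outgoing edge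
-- lie in facets joined by a strong chain of facets all containing v, i.e.
-- in the same strong component of the closed star of v.

module Walks {n} {Δ : Complex n} (closed : IsSimplicialComplex Δ) where

  StarChain : Fin n → Subset n → Subset n → Set
  StarChain v = Star (StrongStep (ClosedStar Δ v))

  vertexOfFacet : ∀ {v τ} → Facet Δ τ → v ∈ τ → IsVertex Δ v
  vertexOfFacet Fτ v∈τ = closed _ _ (proj₁ Fτ) (⁅⁆⊆ v∈τ)

  starFacet : ∀ {v τ} → Facet Δ τ → v ∈ τ → Facet (ClosedStar Δ v) τ
  starFacet (Δτ , maximal) v∈τ =
    (_ , Δτ , v∈τ , ⊆-refl) , λ ρ (τ' , Δτ' , _ , ρ⊆τ') τ⊆ρ → maximal ρ (closed ρ τ' Δτ' ρ⊆τ') τ⊆ρ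

  starStep : ∀ {v τ τ'} → v ∈ τ → v ∈ τ' → StrongStep Δ τ τ' → StrongStep (ClosedStar Δ v) τ τ'
  starStep v∈τ v∈τ' (Fτ , Fτ' , c , c') = starFacet Fτ v∈τ , starFacet Fτ' v∈τ' , c , c'

  sameComponent : ∀ {v τ τ'} → Facet Δ τ → v ∈ τ → StarChain v τ τ' → SameComponent (ClosedStar Δ v) τ τ'
  sameComponent {τ = τ} {τ'} Fτ v∈τ chain = τ , F , (τ , (F , ε) , ⊆-refl) , (τ' , (F , chain) , ⊆-refl)
    where F = starFacet Fτ v∈τ

  -- the first edge of the walk R, if there is one, lies in the facet τ
  StartsIn : ∀ {σ u w} → StrongWalk Δ σ u w → Subset n → Set
  StartsIn R τ = ∀ i → toℕ i ≡ 0 → StrongWalk.fac R i ≡ τ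

  trivialWalk : ∀ {σ u} → IsVertex Δ u → u ∉ σ → StrongWalk Δ σ u u
  trivialWalk {u = u} vertex u∉σ = record
    { walk = record
      { len = 0 ; vert = λ _ → u ; start = refl ; finish = refl
      ; isVertex = λ _ → vertex ; avoids = λ _ → u∉σ ; distinct = λ () ; isEdge = λ () }
    ; fac = λ () ; facIsFacet = λ () ; edgeInFac = λ () ; strong = λ () }

  -- prepend the edge u u' lying in the facet τ to a walk R from u'; the
  -- walk is strong at u' as τ is joined to the first facet of R in the
  -- closed star of u'
  consWalk : ∀ {σ u u' w τ τ'} → u ≢ u' → Facet Δ τ → u ∈ τ → u' ∈ τ → u ∉ σ →
    StarChain u' τ τ' → (R : StrongWalk Δ σ u' w) → StartsIn R τ' → StrongWalk Δ σ u w
  consWalk {σ} {u} {u'} {w} {τ} {τ'} u≢u' Fτ u∈τ u'∈τ u∉σ chain R R-starts = record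
    { walk = record
      { len = suc R.len ; vert = vert ; start = refl ; finish = R.finish
      ; isVertex = isVertex ; avoids = avoids ; distinct = distinct ; isEdge = λ i → closed _ _ (proj₁ (facIsFacet i)) (edgeInFac i) }
    ; fac = fac ; facIsFacet = facIsFacet ; edgeInFac = edgeInFac ; strong = strong }
    where
    module R = StrongWalk R
    vert : Fin (suc (suc R.len)) → Fin n
    vert zero = u
    vert (suc i) = R.vert i
    isVertex : ∀ i → IsVertex Δ (vert i)
    isVertex zero = vertexOfFacet Fτ u∈τ
    isVertex (suc i) = R.isVertex i
    avoids : ∀ i → vert i ∉ σ
    avoids zero = u∉σ
    avoids (suc i) = R.avoids i
    distinct : ∀ i → vert (inject₁ i) ≢ vert (suc i)
    distinct zero = subst (u ≢_) (sym R.start) u≢u'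
    distinct (suc i) = R.distinct i
    fac : Fin (suc R.len) → Subset n
    fac zero = τ
    fac (suc i) = R.fac i
    facIsFacet : ∀ i → Facet Δ (fac i)
    facIsFacet zero = Fτ
    facIsFacet (suc i) = R.facIsFacet i
    edgeInFac : ∀ i → edge (vert (inject₁ i)) (vert (suc i)) ⊆ fac i
    edgeInFac zero = ∪⊆ (⁅⁆⊆ u∈τ) (⁅⁆⊆ (subst (_∈ τ) (sym R.start) u'∈τ))
    edgeInFac (suc i) = R.edgeInFac i
    strong : ∀ i j → suc (toℕ i) ≡ toℕ j → SameComponent (ClosedStar Δ (vert (suc i))) (fac i) (fac j)
    strong zero (suc j) 1≡1+j = subst₂ (λ v ρ → SameComponent (ClosedStar Δ v) τ ρ)
      (sym R.start) (sym (R-starts j (ℕ.suc-injective (sym 1≡1+j)))) (sameComponent Fτ u'∈τ chain)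
    strong (suc i) (suc j) e = R.strong i j (ℕ.suc-injective e)

  walkAlong : ∀ {σ τ τₑ v w} → AvoidingChain Δ σ τ τₑ → Facet Δ τ → Facet Δ τₑ →
    v ∈ τ → v ∉ σ → w ∈ τₑ → w ∉ σ →
    ∃[ τ' ] (Σ (StrongWalk Δ σ v w) (λ R → StartsIn R τ') × StarChain v τ τ')
  walkAlong {τ = τ} {v = v} {w} ε Fτ _ v∈τ v∉σ w∈τ w∉σ with v ≟ᶠ w
  ... | yes refl = τ , (trivialWalk (vertexOfFacet Fτ v∈τ) v∉σ , λ ()) , ε
  ... | no v≢w = τ , (consWalk v≢w Fτ v∈τ w∈τ v∉σ ε (trivialWalk (vertexOfFacet Fτ w∈τ) w∉σ) (λ ()) , λ { zero _ → refl }) , ε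
  walkAlong {τ = τ} {v = v} ((step , c , c∈τ , c∈τ₁ , c∉σ) ◅ chain) Fτ Fτₑ v∈τ v∉σ w∈τₑ w∉σ
    with walkAlong chain (proj₁ (proj₂ step)) Fτₑ c∈τ₁ c∉σ w∈τₑ w∉σ
  ... | τ' , (R , R-starts) , chainAtc with v ≟ᶠ c
  ...   | yes refl = τ' , (R , R-starts) , starStep v∈τ c∈τ₁ step ◅ chainAtc
  ...   | no v≢c = τ , (consWalk v≢c Fτ v∈τ c∈τ v∉σ (starStep c∈τ c∈τ₁ step ◅ chainAtc) R R-starts , λ { zero _ → refl }) , ε

module Connectivity {n} {Δ : Complex n} {d : ℕ} (2≤d : 2 ≤ d) (pm : IsPseudomanifold Δ d) where
  open Pseudomanifold pm
  open FacetEnumeration pm using (vertexInFacet)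
  open Detours 2≤d pm using (avoidSmall; avoidFacet)
  open Walks closed using (walkAlong; vertexOfFacet)

  walkVia : ∀ {σ u w} → (∀ {τ τ'} → Facet Δ τ → Facet Δ τ' → u ∈ τ → w ∈ τ' → AvoidingChain Δ σ τ τ') →
    IsVertex Δ u → IsVertex Δ w → u ∉ σ → w ∉ σ → StrongWalk Δ σ u w
  walkVia avoid u-vertex w-vertex u∉σ w∉σ with vertexInFacet u-vertex | vertexInFacet w-vertex
  ... | τ , Fτ , u∈τ | τ' , Fτ' , w∈τ' =
    proj₁ (proj₁ (proj₂ (walkAlong (avoid Fτ Fτ' u∈τ w∈τ') Fτ Fτ' u∈τ u∉σ w∈τ' w∉σ)))

  walkAvoidingSmall : ∀ {σ u w} → ∣ σ ∣ < d → IsVertex Δ u → IsVertex Δ w → u ∉ σ → w ∉ σ → StrongWalk Δ σ u w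
  walkAvoidingSmall σ<d = walkVia (λ Fτ Fτ' _ _ → avoidSmall σ<d (stronglyConnected Fτ Fτ'))

  -- part (ii): σ is a face, so either small or a facet
  walkAvoidingFace : ∀ {σ u w} → Δ σ → IsVertex Δ u → IsVertex Δ w → u ∉ σ → w ∉ σ → StrongWalk Δ σ u w
  walkAvoidingFace {σ} Δσ u-vertex w-vertex u∉σ w∉σ with suc ∣ σ ∣ ≤? d
  ... | yes σ<d = walkAvoidingSmall σ<d u-vertex w-vertex u∉σ w∉σ
  ... | no σ≮d = walkVia (λ Fτ Fτ' u∈τ w∈τ' → avoidFacet Fσ (stronglyConnected Fτ Fτ')
                           (λ { refl → u∉σ u∈τ }) (λ { refl → w∉σ w∈τ' }))
                         u-vertex w-vertex u∉σ w∉σ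
    where
    Fσ : Facet Δ σ
    Fσ = full⇒facet Δσ (s≤s⁻¹ (ℕ.≰⇒> σ≮d))

  -- σ₀ together with a vertex of another facet: d + 1 vertices
  manyVertices : ∃[ S ] ((∀ v → v ∈ S → IsVertex Δ v) × suc d ≤ ∣ S ∣)
  manyVertices
    with inhabited {σ = σ₀} (subst (0 <_) (sym ∣σ₀∣) (ℕ.<-≤-trans (s≤s z≤n) 2≤d))
  ... | x , x∈σ₀ with otherFacet (facet-x σ₀-facet x∈σ₀) σ₀-facet (p─q⊆p σ₀ ⁅ x ⁆)
  ... | G , FG , _ , G≢σ₀ with ⊈⇒witness (λ G⊆σ₀ → G≢σ₀ (facet-⊆ FG σ₀-facet G⊆σ₀))
  ... | z , z∈G , z∉σ₀ = σ₀ +ₛ z , vertices , ℕ.≤-reflexive (sym (trans (∣+ₛ∣ z∉σ₀) (cong suc ∣σ₀∣)))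
    where
    vertices : ∀ v → v ∈ σ₀ +ₛ z → IsVertex Δ v
    vertices v v∈ with ∈+ₛ⁻ v∈
    ... | inj₁ v∈σ₀ = vertexOfFacet σ₀-facet v∈σ₀
    ... | inj₂ refl = vertexOfFacet FG z∈G

  vertexOutside : ∀ {S} → ∣ S ∣ ≤ d → ∃[ v ] (IsVertex Δ v × v ∉ S)
  vertexOutside {S} S≤d = outsideOf manyVertices
    where
    outsideOf : ∃[ S' ] ((∀ v → v ∈ S' → IsVertex Δ v) × suc d ≤ ∣ S' ∣) → ∃[ v ] (IsVertex Δ v × v ∉ S)
    outsideOf (S' , vertices , d<S') with larger⇒witness (ℕ.≤-<-trans S≤d d<S')
    ... | v , v∈S' , v∉S = v , vertices v v∈S' , v∉S

proposition2p3 : ∀ {n : ℕ} (Δ : Complex n) (d : ℕ) → 2 ≤ d → IsPseudomanifold Δ d →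
    ((∀ (σ : Subset n) → (∀ v → v ∈ σ → IsVertex Δ v) → ∣ σ ∣ < d →
        ∀ (u w : Fin n) → IsVertex Δ u → IsVertex Δ w → u ∉ σ → w ∉ σ →
        StrongWalk Δ σ u w)
     × IsMConnected Δ d)
    ×
    ((∀ (σ : Subset n) → Δ σ →
        ∀ (u w : Fin n) → IsVertex Δ u → IsVertex Δ w → u ∉ σ → w ∉ σ →
        StrongWalk Δ σ u w)
     × (∀ (σ : Subset n) → Δ σ → ConnectedAvoiding Δ σ))
proposition2p3 Δ d 2≤d pm =
  ( ((λ σ _ σ<d u w → walkAvoidingSmall σ<d) ,
     (manyVertices , λ S _ S<d → vertexOutside (ℕ.<⇒≤ S<d) ,
                                 λ u w u-vertex w-vertex u∉S w∉S →
                                   StrongWalk.walk (walkAvoidingSmall S<d u-vertex w-vertex u∉S w∉S)))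
  , ((λ σ Δσ u w → walkAvoidingFace Δσ) ,
     λ σ Δσ → vertexOutside (faceSize≤d Δσ) ,
              λ u w u-vertex w-vertex u∉σ w∉σ →
                StrongWalk.walk (walkAvoidingFace Δσ u-vertex w-vertex u∉σ w∉σ)) )
  where
  open Connectivity 2≤d pm
  open Pseudomanifold pm using (faceSize≤d)
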